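{- Let $G=\bigcup_{k=1}^n C_{i_k}$ be the disjoint union of $n\geq 1$ cycles of lengths $i_1,\ldots,i_n\geq 3$. If at least one cycle length $i_k$ is odd, then $G$ is not total prime.
   Context: All graphs are finite and simple. For a graph $G$ with vertex set $V$ and edge set $E$, a total prime labeling is a bijection $\ell: V\cup E\to\{1,2,\ldots,|V|+|E|\}$ such that (i) for every pair of adjacent vertices $u,v$, $\gcd(\ell(u),\ell(v))=1$, and (ii) for every vertex $v$ of degree at least 2, the greatest common divisor of the labels $\ell(uv)$ over all edges $uv$ incident to $v$ equals 1. A graph is total prime if it admits a total prime labeling. $C_r$ denotes the cycle on $r$ vertices, and $\bigcup$ denotes vertex-disjoint union of graphs. -}

module Defs where

open import Data.Nat using (ℕ; suc; _≤_; _%_)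
open import Data.Nat.DivMod using (m%n<n)
open import Data.Nat.Divisibility using (_∣_)
open import Data.Fin using (Fin; toℕ; fromℕ<)
open import Data.Product using (Σ; _×_; _,_; proj₁; proj₂)
open import Data.Sum using (_⊎_; inj₁; inj₂)
open import Relation.Binary.PropositionalEquality using (_≡_)
open import Relation.Nullary using (¬_)
open import Function.Definitions using (Bijective)

record Graph : Set₁ where
  field
    V    : Set
    E    : Set
    ends : E → V × V

module _ (G : Graph) where
  open Graph G

  Adjacent : V → V → Set
  Adjacent u v = Σ E λ e → (ends e ≡ (u , v)) ⊎ (ends e ≡ (v , u))

  Incident : E → V → Set
  Incident e v = (proj₁ (ends e) ≡ v) ⊎ (proj₂ (ends e) ≡ v)

  DegreeAtLeast2 : V → Set
  DegreeAtLeast2 v = Σ E λ e₁ → Σ E λ e₂ → ¬ (e₁ ≡ e₂) × Incident e₁ v × Incident e₂ v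

  -- A total prime labeling with label set {1,…,m}; the bijection forces
  -- m = |V| + |E|.  The label of x is suc (toℕ (ℓ x)).
  IsTotalPrimeLabeling : (m : ℕ) → (V ⊎ E → Fin m) → Set
  IsTotalPrimeLabeling m ℓ =
    Bijective _≡_ _≡_ ℓ
    × (∀ u v → Adjacent u v → ∀ d → d ∣ lab (inj₁ u) → d ∣ lab (inj₁ v) → d ∣ 1)
    × (∀ v → DegreeAtLeast2 v →
         ∀ d → (∀ e → Incident e v → d ∣ lab (inj₂ e)) → d ∣ 1)
    where
    lab : V ⊎ E → ℕ
    lab x = suc (toℕ (ℓ x))

  TotalPrime : Set
  TotalPrime = Σ ℕ λ m → Σ (V ⊎ E → Fin m) λ ℓ → IsTotalPrimeLabeling m ℓ

sucMod : ∀ m → Fin m → Fin m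
sucMod (suc m) j = fromℕ< (m%n<n (suc (toℕ j)) (suc m))

-- Vertices of the k-th cycle are (k , j), j : Fin (len k); its edges are
-- indexed the same way, edge (k , j) joining (k , j) and (k , j+1 mod len k).
-- (This is the cycle C_{len k} whenever len k ≥ 3.)
CycleUnion : (n : ℕ) → (Fin n → ℕ) → Graph
CycleUnion n len = record
  { V    = Σ (Fin n) λ k → Fin (len k)
  ; E    = Σ (Fin n) λ k → Fin (len k)
  ; ends = λ { (k , j) → ((k , j) , (k , sucMod (len k) j)) }
  }

-- Give every vertex and every edge of the union a successor: the next vertex, resp. the
-- next edge, along its cycle.  Coprimality of adjacent vertex labels, resp. the gcd
-- condition at the vertex shared by two consecutive edges (with d = 2), says that an
-- element with an even label has a successor with an odd label.  Since the successor map is injective and the labels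
-- 1, …, m contain at most one more odd than even number, at most one element with an
-- odd label can have a successor with an odd label.  But the parities along an odd
-- cycle cannot alternate, so its vertices and its edges each contain such an element.
module Submission where

open import Defs
open import Axiom.UniquenessOfIdentityProofs using (module Decidable⇒UIP)
open import Data.Bool using (Bool; true; false; not)
open import Data.Bool.Properties using (not-involutive)
open import Data.Empty using (⊥-elim)
open import Data.Fin using (Fin; toℕ; fromℕ; inject₁; punchOut) renaming (zero to fzero; suc to fsuc)
open import Data.Fin.Properties
  using (_≟_; any?; toℕ-injective; toℕ-fromℕ; toℕ-fromℕ<; toℕ-inject₁; toℕ<n; suc-injective;
         inject₁-injective; injective⇒≤; punchOut-injective)
open import Data.Fin.Relation.Unary.Top using (view; ‵fromℕ; ‵inject₁)
open import Data.Nat using (ℕ; zero; suc; _%_; _≤_; s≤s)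
open import Data.Nat.DivMod using (m<n⇒m%n≡m; n%n≡0)
open import Data.Nat.Divisibility using (_∣_; _∣?_; _∣0; ∣1⇒≡1; ∣-refl; ∣m∣n⇒∣m+n)
open import Data.Nat.GeneralisedArithmetic using (fold)
open import Data.Nat.Properties using (1+n≢n; 1+n≰n; <⇒≤)
open import Data.Product using (Σ; ∃; _×_; _,_; proj₁; proj₂; uncurry)
open import Data.Product.Properties using (,-injectiveˡ; ,-injectiveʳ-UIP)
open import Data.Sum as Sum using (_⊎_; inj₁; inj₂)
open import Data.Sum.Properties using (inj₁-injective; inj₂-injective)
open import Function.Base using (id; _∘_; _∋_; case_of_)
open import Function.Bundles using (Inverse; mk⤖)
open import Function.Definitions using (Bijective; Injective; StrictlySurjective)
open import Function.Properties.Bijection using (⤖⇒↔)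
open import Relation.Binary.PropositionalEquality
  using (_≡_; _≢_; refl; sym; trans; cong; subst; module ≡-Reasoning)
open import Relation.Nullary using (¬_; yes; no; does)
open import Relation.Nullary.Decidable using (¬?; _×-dec_)
open import Relation.Unary using (Pred; Decidable)

open ≡-Reasoning

sucMod-inject₁ : ∀ {L} (i : Fin L) → sucMod (suc L) (inject₁ i) ≡ fsuc i
sucMod-inject₁ {L} i = toℕ-injective (begin
  toℕ (sucMod (suc L) (inject₁ i)) ≡⟨ toℕ-fromℕ< _ ⟩
  suc (toℕ (inject₁ i)) % suc L    ≡⟨ cong (λ t → suc t % suc L) (toℕ-inject₁ i) ⟩
  suc (toℕ i) % suc L              ≡⟨ m<n⇒m%n≡m (s≤s (toℕ<n i)) ⟩
  suc (toℕ i)                      ∎)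

sucMod-fromℕ : ∀ L → sucMod (suc L) (fromℕ L) ≡ fzero
sucMod-fromℕ L = toℕ-injective (begin
  toℕ (sucMod (suc L) (fromℕ L)) ≡⟨ toℕ-fromℕ< _ ⟩
  suc (toℕ (fromℕ L)) % suc L    ≡⟨ cong (λ t → suc t % suc L) (toℕ-fromℕ L) ⟩
  suc L % suc L                  ≡⟨ n%n≡0 (suc L) ⟩
  0                              ∎)

sucMod-injective : ∀ {L} → Injective _≡_ _≡_ (sucMod L)
sucMod-injective {suc L} {i} {j} eq with view i | view j
... | ‵fromℕ     | ‵fromℕ     = refl
... | ‵fromℕ     | ‵inject₁ j with () ← trans (sym (sucMod-fromℕ L)) (trans eq (sucMod-inject₁ j))
... | ‵inject₁ i | ‵fromℕ     with () ← trans (sym (sucMod-fromℕ L)) (trans (sym eq) (sucMod-inject₁ i))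
... | ‵inject₁ i | ‵inject₁ j =
  cong inject₁ (suc-injective (trans (sym (sucMod-inject₁ i)) (trans eq (sucMod-inject₁ j))))

sucMod-fixedPointFree : ∀ {L} → 2 ≤ L → (j : Fin L) → sucMod L j ≢ j
sucMod-fixedPointFree {suc (suc L)} (s≤s (s≤s _)) j eq with view j
... | ‵fromℕ     with () ← trans (sym (sucMod-fromℕ (suc L))) eq
... | ‵inject₁ i = 1+n≢n (begin
  suc (toℕ i)                ≡⟨ cong toℕ (sym (sucMod-inject₁ i)) ⟩
  toℕ (sucMod _ (inject₁ i)) ≡⟨ cong toℕ eq ⟩
  toℕ (inject₁ i)            ≡⟨ toℕ-inject₁ i ⟩
  toℕ i                      ∎)

stepwise⇒fromℕ≡fold : ∀ {a} {A : Set a} (f : A → A) L (c : Fin (suc L) → A) →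
  (∀ i → c (fsuc i) ≡ f (c (inject₁ i))) → c (fromℕ L) ≡ fold (c fzero) f L
stepwise⇒fromℕ≡fold f zero    c step = refl
stepwise⇒fromℕ≡fold f (suc L) c step = begin
  c (fsuc (fromℕ L))        ≡⟨ step (fromℕ L) ⟩
  f (c (inject₁ (fromℕ L))) ≡⟨ cong f (stepwise⇒fromℕ≡fold f L (c ∘ inject₁) (step ∘ inject₁)) ⟩
  f (fold (c fzero) f L)    ∎

fold-not-fixed⇒even : ∀ t {x} → fold x not t ≡ x → 2 ∣ t
fold-not-fixed⇒even zero                _   = 2 ∣0
fold-not-fixed⇒even (suc zero)    {false} ()
fold-not-fixed⇒even (suc zero)    {true}  ()
fold-not-fixed⇒even (suc (suc t))       eq  =
  ∣m∣n⇒∣m+n ∣-refl (fold-not-fixed⇒even t (trans (sym (not-involutive _)) eq))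

alternating⇒even : ∀ {L} (c : Fin L → Bool) → (∀ j → c (sucMod L j) ≡ not (c j)) → 2 ∣ L
alternating⇒even {zero}  c alt = 2 ∣0
alternating⇒even {suc L} c alt = fold-not-fixed⇒even (suc L) (begin
  not (fold (c fzero) not L)   ≡⟨ cong not (sym (stepwise⇒fromℕ≡fold not L c step)) ⟩
  not (c (fromℕ L))            ≡⟨ sym (alt (fromℕ L)) ⟩
  c (sucMod (suc L) (fromℕ L)) ≡⟨ cong c (sucMod-fromℕ L) ⟩
  c fzero                      ∎)
  where
  step : ∀ i → c (fsuc i) ≡ not (c (inject₁ i))
  step i = trans (cong c (sym (sucMod-inject₁ i))) (alt (inject₁ i))

oddCycle⇒consecutive¬ : ∀ {L p} {P : Pred (Fin L) p} → ¬ 2 ∣ L → Decidable P →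
  (∀ j → P j → ¬ P (sucMod L j)) → ∃ λ j → ¬ P j × ¬ P (sucMod L j)
oddCycle⇒consecutive¬ {L} odd P? noConsecutive
  with any? (λ j → ¬? (P? j) ×-dec ¬? (P? (sucMod L j)))
... | yes found = found
... | no  none  = ⊥-elim (odd (alternating⇒even (does ∘ P?) alternates))
  where
  alternates : ∀ j → does (P? (sucMod L j)) ≡ not (does (P? j))
  alternates j with P? j | P? (sucMod L j)
  ... | yes pj  | yes pj′ = ⊥-elim (noConsecutive j pj pj′)
  ... | yes _   | no  _   = refl
  ... | no  _   | yes _   = refl
  ... | no  ¬pj | no ¬pj′ = ⊥-elim (none (j , ¬pj , ¬pj′))

injective⇒strictlySurjective : ∀ {m} {f : Fin m → Fin m} → Injective _≡_ _≡_ f → StrictlySurjective _≡_ f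
injective⇒strictlySurjective {suc m} {f} f-injective y with any? (λ x → f x ≟ y)
... | yes hit  = hit
... | no  miss = ⊥-elim (1+n≰n (injective⇒≤ punched-injective))
  where
  y≢f : ∀ x → y ≢ f x
  y≢f x eq = miss (x , sym eq)

  punched : Fin (suc m) → Fin m
  punched x = punchOut (y≢f x)

  punched-injective : Injective _≡_ _≡_ punched
  punched-injective eq = f-injective (punchOut-injective (y≢f _) (y≢f _) eq)

-- As in IsTotalPrimeLabeling, i : Fin m stands for the label suc (toℕ i).
EvenLabel : ∀ {m} → Pred (Fin m) _
EvenLabel i = 2 ∣ suc (toℕ i)

evenLabel? : ∀ {m} → Decidable (EvenLabel {m})
evenLabel? i = 2 ∣? suc (toℕ i)

module _ {a} {A : Set a} {m} (ℓ : A → Fin m) (s : A → A) where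

  NoEvenStep : Set a
  NoEvenStep = ∀ x → EvenLabel (ℓ x) → ¬ EvenLabel (ℓ (s x))

  OddStep : Pred A _
  OddStep x = ¬ EvenLabel (ℓ x) × ¬ EvenLabel (ℓ (s x))

¬2∣suc⇒2∣ : ∀ n → ¬ 2 ∣ suc n → 2 ∣ n
¬2∣suc⇒2∣ zero          _   = 2 ∣0
¬2∣suc⇒2∣ (suc zero)    odd = ⊥-elim (odd ∣-refl)
¬2∣suc⇒2∣ (suc (suc n)) odd = ∣m∣n⇒∣m+n ∣-refl (¬2∣suc⇒2∣ n (odd ∘ ∣m∣n⇒∣m+n ∣-refl))

¬evenLabel-fsuc⇒evenLabel-inject₁ : ∀ {m} {i : Fin m} → ¬ EvenLabel (fsuc i) → EvenLabel (inject₁ i)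
¬evenLabel-fsuc⇒evenLabel-inject₁ {i = i} odd =
  subst (λ t → 2 ∣ suc t) (sym (toℕ-inject₁ i)) (¬2∣suc⇒2∣ (suc (toℕ i)) odd)

-- Θ moves even labels along s and odd labels one down, except that label 1 goes to the
-- odd label a, which is not of the form s i with i even.  It is injective, so it is onto,
-- and this rules out a second such odd label b.
module EvenOddInjection {m} {s : Fin (suc m) → Fin (suc m)}
  (s-injective : Injective _≡_ _≡_ s) (noEvenStep : NoEvenStep id s)
  {a : Fin (suc m)} (a-odd : ¬ EvenLabel a) (a-outside : ∀ i → EvenLabel i → s i ≢ a) where

  predOr : Fin (suc m) → Fin (suc m)
  predOr fzero    = a
  predOr (fsuc i) = inject₁ i

  predOr-injective-on-odd : ∀ {i j} → ¬ EvenLabel i → ¬ EvenLabel j → predOr i ≡ predOr j → i ≡ j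
  predOr-injective-on-odd {fzero}  {fzero}  _  _  _  = refl
  predOr-injective-on-odd {fzero}  {fsuc j} _  oj eq =
    ⊥-elim (a-odd (subst EvenLabel (sym eq) (¬evenLabel-fsuc⇒evenLabel-inject₁ oj)))
  predOr-injective-on-odd {fsuc i} {fzero}  oi _  eq =
    ⊥-elim (a-odd (subst EvenLabel eq (¬evenLabel-fsuc⇒evenLabel-inject₁ oi)))
  predOr-injective-on-odd {fsuc i} {fsuc j} _  _  eq = cong fsuc (inject₁-injective eq)

  s≢predOr : ∀ {i j} → EvenLabel i → ¬ EvenLabel j → s i ≢ predOr j
  s≢predOr {i} {fzero}  ei _  eq = a-outside i ei eq
  s≢predOr {i} {fsuc j} ei oj eq =
    noEvenStep i ei (subst EvenLabel (sym eq) (¬evenLabel-fsuc⇒evenLabel-inject₁ oj))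

  Θ : Fin (suc m) → Fin (suc m)
  Θ i with evenLabel? i
  ... | yes _ = s i
  ... | no  _ = predOr i

  Θ-injective : Injective _≡_ _≡_ Θ
  Θ-injective {i} {j} eq with evenLabel? i | evenLabel? j
  ... | yes _  | yes _  = s-injective eq
  ... | yes ei | no  oj = ⊥-elim (s≢predOr ei oj eq)
  ... | no  oi | yes ej = ⊥-elim (s≢predOr ej oi (sym eq))
  ... | no  oi | no  oj = predOr-injective-on-odd oi oj eq

  Θ-misses : ∀ {b} → ¬ EvenLabel b → (∀ i → EvenLabel i → s i ≢ b) → a ≢ b → ∀ i → Θ i ≢ b
  Θ-misses b-odd b-outside a≢b i eq with evenLabel? i
  Θ-misses b-odd b-outside a≢b i        eq | yes ei = b-outside i ei eq
  Θ-misses b-odd b-outside a≢b fzero    eq | no  _  = a≢b eq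
  Θ-misses b-odd b-outside a≢b (fsuc i) eq | no  oi =
    b-odd (subst EvenLabel eq (¬evenLabel-fsuc⇒evenLabel-inject₁ oi))

oddStep-unique : ∀ {m} {s : Fin m → Fin m} → Injective _≡_ _≡_ s → NoEvenStep id s →
  ∀ {i j} → OddStep id s i → OddStep id s j → i ≡ j
oddStep-unique {suc m} {s} s-injective noEvenStep {i} {j} (oi , osi) (oj , osj) with s i ≟ s j
... | yes eq  = s-injective eq
... | no  a≢b =
  ⊥-elim (uncurry (Θ-misses osj (outside oj) a≢b) (injective⇒strictlySurjective Θ-injective (s j)))
  where
  outside : ∀ {l} → ¬ EvenLabel l → ∀ k → EvenLabel k → s k ≢ s l
  outside ol k ek eq = ol (subst EvenLabel (s-injective eq) ek)

  open EvenOddInjection s-injective noEvenStep osi (outside oi)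

oddStep-unique-labelled : ∀ {a} {A : Set a} {m} {ℓ : A → Fin m} → Bijective _≡_ _≡_ ℓ →
  {s : A → A} → Injective _≡_ _≡_ s → NoEvenStep ℓ s →
  ∀ {x y} → OddStep ℓ s x → OddStep ℓ s y → x ≡ y
oddStep-unique-labelled {ℓ = ℓ} ℓ-bijective {s} s-injective noEvenStep (ox , osx) (oy , osy) =
  proj₁ ℓ-bijective (oddStep-unique σ-injective σ-noEvenStep (ox , odd-σ∘ℓ osx) (oy , odd-σ∘ℓ osy))
  where
  open Inverse (⤖⇒↔ (mk⤖ ℓ-bijective)) using (from; strictlyInverseˡ; strictlyInverseʳ)

  σ : Fin _ → Fin _
  σ = ℓ ∘ s ∘ from

  σ-injective : Injective _≡_ _≡_ σ
  σ-injective {i} {j} eq = begin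
    i          ≡⟨ sym (strictlyInverseˡ i) ⟩
    ℓ (from i) ≡⟨ cong ℓ (s-injective (proj₁ ℓ-bijective eq)) ⟩
    ℓ (from j) ≡⟨ strictlyInverseˡ j ⟩
    j          ∎

  σ-noEvenStep : NoEvenStep id σ
  σ-noEvenStep i ei = noEvenStep (from i) (subst EvenLabel (sym (strictlyInverseˡ i)) ei)

  odd-σ∘ℓ : ∀ {z} → ¬ EvenLabel (ℓ (s z)) → ¬ EvenLabel (σ (ℓ z))
  odd-σ∘ℓ {z} = subst (¬_ ∘ EvenLabel) (cong (ℓ ∘ s) (sym (strictlyInverseʳ z)))

2∤1 : ¬ 2 ∣ 1
2∤1 2∣1 with () ← ∣1⇒≡1 2∣1

module _ {n : ℕ} {len : Fin n → ℕ} where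
  open Graph (CycleUnion n len)

  private
    Position : Set
    Position = Σ (Fin n) (λ k → Fin (len k))

    ,-injectiveʳ-Position : ∀ {k} {i j : Fin (len k)} → (Position ∋ (k , i)) ≡ (k , j) → i ≡ j
    ,-injectiveʳ-Position = ,-injectiveʳ-UIP (Decidable⇒UIP.≡-irrelevant _≟_)

  next : Position → Position
  next (k , j) = k , sucMod (len k) j

  next-injective : Injective _≡_ _≡_ next
  next-injective {k , _} {_ , _} eq with refl ← ,-injectiveˡ eq =
    cong (k ,_) (sucMod-injective (,-injectiveʳ-Position eq))

  successor : V ⊎ E → V ⊎ E
  successor = Sum.map next next

  successor-injective : Injective _≡_ _≡_ successor
  successor-injective {inj₁ _} {inj₁ _} eq = cong inj₁ (next-injective (inj₁-injective eq))
  successor-injective {inj₂ _} {inj₂ _} eq = cong inj₂ (next-injective (inj₂-injective eq))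

  totalPrime⇒noEvenStep : (∀ k → 2 ≤ len k) → ∀ {m ℓ} → IsTotalPrimeLabeling (CycleUnion n len) m ℓ →
    NoEvenStep ℓ successor
  totalPrime⇒noEvenStep _ (_ , coprime-adjacent , _) (inj₁ v) ev ev′ =
    2∤1 (coprime-adjacent v (next v) (v , inj₁ refl) 2 ev ev′)
  totalPrime⇒noEvenStep 2≤len {ℓ = ℓ} (_ , _ , coprime-incident) (inj₂ e@(k , j)) ev ev′ =
    2∤1 (coprime-incident (next e) (e , next e , e≢next , inj₂ refl , inj₁ refl) 2 incident-even)
    where
    e≢next : e ≢ next e
    e≢next eq = sucMod-fixedPointFree (2≤len k) j (sym (,-injectiveʳ-Position eq))

    incident-even : ∀ f → Incident (CycleUnion n len) f (next e) → EvenLabel (ℓ (inj₂ f))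
    incident-even f (inj₁ f≡next)    = subst (EvenLabel ∘ ℓ ∘ inj₂) (sym f≡next) ev′
    incident-even f (inj₂ next≡next) = subst (EvenLabel ∘ ℓ ∘ inj₂) (sym (next-injective next≡next)) ev

mainTheorem17 : (n : ℕ) → 1 ≤ n → (len : Fin n → ℕ) → (∀ k → 3 ≤ len k)
    → Σ (Fin n) (λ k → ¬ (2 ∣ len k))
    → ¬ TotalPrime (CycleUnion n len)
mainTheorem17 n _ len 3≤len (k , odd) (m , ℓ , isTotalPrime@(ℓ-bijective , _)) =
  case oddStep-unique-labelled ℓ-bijective successor-injective noEvenStep
         (proj₂ vertexStep) (proj₂ edgeStep) of λ ()
  where
  noEvenStep : NoEvenStep ℓ successor
  noEvenStep = totalPrime⇒noEvenStep (<⇒≤ ∘ 3≤len) isTotalPrime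

  vertexStep : ∃ λ j → OddStep ℓ successor (inj₁ (k , j))
  vertexStep = oddCycle⇒consecutive¬ odd (evenLabel? ∘ ℓ ∘ inj₁ ∘ (k ,_)) (noEvenStep ∘ inj₁ ∘ (k ,_))

  edgeStep : ∃ λ j → OddStep ℓ successor (inj₂ (k , j))
  edgeStep = oddCycle⇒consecutive¬ odd (evenLabel? ∘ ℓ ∘ inj₂ ∘ (k ,_)) (noEvenStep ∘ inj₂ ∘ (k ,_))
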